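{- Let $H$ be a regular tournament with $2m+1$ vertices, and let $v\in V(H)$. Suppose there is no directed cycle with vertices $p\hbox{ - }q\hbox{ - }r\hbox{ - }s\hbox{ - }p$ in order such that $p,r$ are out-neighbours of $v$ and $q,s$ are in-neighbours of $v$. Then $H$ is cyclic.
   Context: A tournament is an orientation of a complete graph. A tournament is regular if all its vertices have the same outdegree and all have the same indegree (so with $2m+1$ vertices each has outdegree and indegree $m$). A tournament $H$ is cyclic if it has an odd number $2m+1$ of vertices which can be ordered $v_1,\ldots,v_{2m+1}$ so that for $1\le i<j\le 2m+1$, $v_i$ is adjacent to $v_j$ (edge directed from $v_i$ to $v_j$) if and only if $j-i\le m$. -}

module Defs where

open import Data.Nat using (ℕ; suc; _+_; _*_; _≤_; _<_; _∸_)
open import Data.Fin using (Fin; toℕ)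
open import Data.Bool using (Bool; true; false)
open import Data.List using (List; length; filter)
open import Data.List using () renaming (allFin to allFinL)
open import Data.Fin.Base using ()
open import Data.Product using (Σ; _×_; ∃)
open import Relation.Binary.PropositionalEquality using (_≡_; _≢_)
open import Relation.Nullary using (¬_)
open import Function.Bundles using (_↔_; Inverse)
open import Data.Sum using (_⊎_)
open import Data.Bool using (_≟_)

Digraph : ℕ → Set
Digraph n = Fin n → Fin n → Bool

_⇒[_]_ : ∀ {n} → Fin n → Digraph n → Fin n → Set
x ⇒[ G ] y = G x y ≡ true

record IsTournament {n : ℕ} (G : Digraph n) : Set where
  field
    irrefl   : ∀ x → ¬ (x ⇒[ G ] x)
    total    : ∀ x y → x ≢ y → (x ⇒[ G ] y) ⊎ (y ⇒[ G ] x)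
    antisym  : ∀ x y → x ⇒[ G ] y → ¬ (y ⇒[ G ] x)

outdeg : ∀ {n} → Digraph n → Fin n → ℕ
outdeg {n} G x = length (filter (λ y → G x y ≟ true) (allFinL n))

indeg : ∀ {n} → Digraph n → Fin n → ℕ
indeg {n} G x = length (filter (λ y → G y x ≟ true) (allFinL n))

IsRegularTournament : (m : ℕ) → Digraph (suc (2 * m)) → Set
IsRegularTournament m G =
  IsTournament G × (∀ x → outdeg G x ≡ m) × (∀ x → indeg G x ≡ m)

IsCyclic : (m : ℕ) → Digraph (suc (2 * m)) → Set
IsCyclic m G =
  Σ (Fin (suc (2 * m)) ↔ Fin (suc (2 * m))) λ σ →
    ∀ (i j : Fin (suc (2 * m))) → toℕ i < toℕ j →
      (Inverse.to σ i ⇒[ G ] Inverse.to σ j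
        → toℕ j ∸ toℕ i ≤ m)
      × (toℕ j ∸ toℕ i ≤ m
        → Inverse.to σ i ⇒[ G ] Inverse.to σ j)

HasAlternatingFourCycle : ∀ {n} → Digraph n → Fin n → Set
HasAlternatingFourCycle {n} G v =
  Σ (Fin n) λ p → Σ (Fin n) λ q → Σ (Fin n) λ r → Σ (Fin n) λ s →
    (p ⇒[ G ] q) × (q ⇒[ G ] r) × (r ⇒[ G ] s) × (s ⇒[ G ] p)
    × (v ⇒[ G ] p) × (v ⇒[ G ] r) × (q ⇒[ G ] v) × (s ⇒[ G ] v)

-- Let A and B be the out- and in-neighbourhoods of v, both of size m. Having no alternating
-- four-cycle through v says precisely that the sets N(a) = {b ∈ B : a → b}, a ∈ A, form a chain
-- under inclusion. For a ∈ A let X be the vertices of A whose set lies below N(a); then no edge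
-- goes from X to B ∖ N(a) nor from N(a) to A ∖ X, and double counting out-degrees in the
-- regular tournament forces ∣N(a)∣ = ∣X∣ + 1 and makes every vertex of X beat every vertex
-- of A ∖ X. So a ↦ ∣N(a)∣ ranks A onto 1..m consistently with the edges inside A; the same
-- argument in the reversed tournament ranks B, and the two ranks of a ∈ A and b ∈ B decide the
-- edge between them. Placing v at 0, A at its ranks and B at 2m + 1 minus its reversed ranks
-- is the cyclic ordering.
module Submission where

open import Defs
open import Data.Nat using (ℕ; zero; suc; _+_; _*_; _∸_; _≤_; _<_; z≤n; s≤s; _<?_; _≟_)
open import Data.Nat.Properties
open import Relation.Binary.Definitions using (tri<; tri≈; tri>)
open import Data.Nat.Tactic.RingSolver using (solve-∀)
open import Algebra.Properties.Semiring.Sum +-*-semiring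
  using (sum; ∑-distrib-+; ∑-comm; *-distribˡ-sum; *-distribʳ-sum; sum-cong-≗; sum-replicate-zero)
open import Data.Bool using (Bool; true; false; not; _∧_)
import Data.Bool as Bool
open import Data.Bool.Properties using (∧-zeroʳ)
open import Data.Fin using (Fin; zero; suc; toℕ; fromℕ<; punchOut)
import Data.Fin as Fin
open import Data.Fin.Properties using (any?; injective⇒≤; punchOut-injective; toℕ-fromℕ<)
open import Data.List using (length; filter; tabulate)
open import Data.Product using (_×_; _,_; proj₁; proj₂; ∃; Σ)
open import Data.Sum using (_⊎_; inj₁; inj₂; swap)
open import Data.Empty using (⊥-elim)
open import Function using (_∘_; id)
open import Function.Bundles using (_↔_; Inverse; mk↔ₛ′)
open import Function.Definitions using (Injective)
open import Relation.Binary.PropositionalEquality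
open import Relation.Nullary using (¬_; Dec; does; yes; no)
open import Relation.Nullary.Decidable using (dec-true; dec-false)

⟦_⟧ : Bool → ℕ
⟦ true ⟧ = 1
⟦ false ⟧ = 0

false≢true : false ≢ true
false≢true ()

does≡true⇒ : ∀ {P : Set} (P? : Dec P) → does P? ≡ true → P
does≡true⇒ (yes p) _ = p

does≡false⇒ : ∀ {P : Set} (P? : Dec P) → does P? ≡ false → ¬ P
does≡false⇒ (no ¬p) _ = ¬p

δ : ∀ {n} → Fin n → Fin n → ℕ
δ i j = ⟦ does (i Fin.≟ j) ⟧

sum-mono-≤ : ∀ {n} {f g : Fin n → ℕ} → (∀ i → f i ≤ g i) → sum f ≤ sum g
sum-mono-≤ {zero} f≤g = z≤n
sum-mono-≤ {suc n} f≤g = +-mono-≤ (f≤g zero) (sum-mono-≤ (f≤g ∘ suc))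

sum-mono-< : ∀ {n} {f g : Fin n → ℕ} → (∀ i → f i ≤ g i) → ∀ k → f k < g k → sum f < sum g
sum-mono-< {suc n} f≤g zero fk<gk = +-mono-<-≤ fk<gk (sum-mono-≤ (f≤g ∘ suc))
sum-mono-< {suc n} f≤g (suc k) fk<gk = +-mono-≤-< (f≤g zero) (sum-mono-< (f≤g ∘ suc) k fk<gk)

sum≡0⇒≡0 : ∀ {n} (f : Fin n → ℕ) → sum f ≡ 0 → ∀ i → f i ≡ 0
sum≡0⇒≡0 {suc n} f eq zero = m+n≡0⇒m≡0 (f zero) eq
sum≡0⇒≡0 {suc n} f eq (suc i) = sum≡0⇒≡0 (f ∘ suc) (m+n≡0⇒n≡0 (f zero) eq) i

≤-sum : ∀ {n} (f : Fin n → ℕ) i → f i ≤ sum f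
≤-sum {suc n} f zero = m≤m+n (f zero) _
≤-sum {suc n} f (suc i) = ≤-trans (≤-sum (f ∘ suc) i) (m≤n+m _ (f zero))

+≤-sum : ∀ {n} (f : Fin n → ℕ) {i j} → i ≢ j → f i + f j ≤ sum f
+≤-sum {suc n} f {zero} {zero} i≢j = ⊥-elim (i≢j refl)
+≤-sum {suc n} f {zero} {suc j} i≢j = +-monoʳ-≤ (f zero) (≤-sum (f ∘ suc) j)
+≤-sum {suc n} f {suc i} {zero} i≢j =
  subst (_≤ sum f) (+-comm (f zero) (f (suc i))) (+-monoʳ-≤ (f zero) (≤-sum (f ∘ suc) i))
+≤-sum {suc n} f {suc i} {suc j} i≢j =
  ≤-trans (+≤-sum (f ∘ suc) (i≢j ∘ cong suc)) (m≤n+m _ (f zero))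

sum-δ : ∀ {n} (i : Fin n) (f : Fin n → ℕ) → sum (λ j → δ i j * f j) ≡ f i
sum-δ {suc n} zero f = begin
  f zero + 0 + sum {n} (λ _ → 0)  ≡⟨ cong₂ _+_ (+-identityʳ (f zero)) (sum-replicate-zero n) ⟩
  f zero + 0                      ≡⟨ +-identityʳ (f zero) ⟩
  f zero                          ∎
  where open ≡-Reasoning
sum-δ {suc n} (suc i) f = sum-δ i (f ∘ suc)

sum-zero : ∀ {n} {f : Fin n → ℕ} → (∀ i → f i ≡ 0) → sum f ≡ 0
sum-zero {n} f≡0 = trans (sum-cong-≗ f≡0) (sum-replicate-zero n)

∑∑-distrib-+ : ∀ {n} (f g : Fin n → Fin n → ℕ) →
  sum (λ x → sum (λ y → f x y + g x y)) ≡ sum (λ x → sum (f x)) + sum (λ x → sum (g x))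
∑∑-distrib-+ f g =
  trans (sum-cong-≗ (λ x → ∑-distrib-+ (f x) (g x))) (∑-distrib-+ (λ x → sum (f x)) (λ x → sum (g x)))

length-filter-tabulate : ∀ {A : Set} {k} (P : A → Bool) (h : Fin k → A) →
  length (filter (λ y → P y Bool.≟ true) (tabulate h)) ≡ sum (λ i → ⟦ P (h i) ⟧)
length-filter-tabulate {k = zero} P h = refl
length-filter-tabulate {k = suc k} P h with P (h zero)
... | true = cong suc (length-filter-tabulate P (h ∘ suc))
... | false = length-filter-tabulate P (h ∘ suc)

χ : ∀ {n} → (Fin n → Bool) → Fin n → ℕ
χ P x = ⟦ P x ⟧

∣_∣ : ∀ {n} → (Fin n → Bool) → ℕ
∣ P ∣ = sum (χ P)

_⊆_ : ∀ {n} → (Fin n → Bool) → (Fin n → Bool) → Set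
P ⊆ Q = ∀ x → P x ≡ true → Q x ≡ true

_∖_ : ∀ {n} → (Fin n → Bool) → (Fin n → Bool) → Fin n → Bool
(P ∖ Q) x = P x ∧ not (Q x)

⟦⟧-idem : ∀ b → ⟦ b ⟧ * ⟦ b ⟧ ≡ ⟦ b ⟧
⟦⟧-idem true = refl
⟦⟧-idem false = refl

∧≡true⇒ : ∀ {a b} → a ∧ b ≡ true → a ≡ true × b ≡ true
∧≡true⇒ {true} {true} _ = refl , refl

∧≡true : ∀ {a b} → a ≡ true → b ≡ true → a ∧ b ≡ true
∧≡true refl refl = refl

∖≡true : ∀ {n} {P Q : Fin n → Bool} {x} → P x ≡ true → Q x ≡ false → (P ∖ Q) x ≡ true
∖≡true {P = P} {Q} {x} Px Qx rewrite Px | Qx = refl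

∖≡true⇒ : ∀ {n} {P Q : Fin n → Bool} {x} → (P ∖ Q) x ≡ true → P x ≡ true × Q x ≡ false
∖≡true⇒ {P = P} {Q} {x} P∖Qx with P x | Q x
... | true | false = refl , refl

χ-mono : ∀ {n} {P Q : Fin n → Bool} → P ⊆ Q → ∀ x → χ P x ≤ χ Q x
χ-mono {P = P} P⊆Q x with P x in Px
... | false = z≤n
... | true rewrite P⊆Q x Px = ≤-refl

∣∣-mono : ∀ {n} {P Q : Fin n → Bool} → P ⊆ Q → ∣ P ∣ ≤ ∣ Q ∣
∣∣-mono P⊆Q = sum-mono-≤ (χ-mono P⊆Q)

∣∣-mono-< : ∀ {n} {P Q : Fin n → Bool} → P ⊆ Q →
  ∀ x → P x ≡ false → Q x ≡ true → ∣ P ∣ < ∣ Q ∣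
∣∣-mono-< P⊆Q x Px Qx = sum-mono-< (χ-mono P⊆Q) x (χPx<χQx Px Qx)
  where
  χPx<χQx : ∀ {a b} → a ≡ false → b ≡ true → ⟦ a ⟧ < ⟦ b ⟧
  χPx<χQx refl refl = s≤s z≤n

∣∣-split : ∀ {n} {P Q : Fin n → Bool} → P ⊆ Q → ∣ P ∣ + ∣ Q ∖ P ∣ ≡ ∣ Q ∣
∣∣-split {P = P} {Q} P⊆Q = trans (sym (∑-distrib-+ (χ P) (χ (Q ∖ P)))) (sum-cong-≗ χ-split)
  where
  χ-split : ∀ x → χ P x + χ (Q ∖ P) x ≡ χ Q x
  χ-split x with P x in Px
  ... | true rewrite P⊆Q x Px = refl
  ... | false with Q x
  ...   | true = refl
  ...   | false = refl

module Tournament {n} (G : Digraph n) (T : IsTournament G) where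

  open IsTournament T

  loopless : ∀ x → G x x ≡ false
  loopless x with G x x in Gxx
  ... | true = ⊥-elim (irrefl x Gxx)
  ... | false = refl

  asym : ∀ x y → G x y ≡ true → G y x ≡ false
  asym x y Gxy with G y x in Gyx
  ... | true = ⊥-elim (antisym x y Gxy Gyx)
  ... | false = refl

  complete : ∀ x y → x ≢ y → G x y ≡ false → G y x ≡ true
  complete x y x≢y Gxy with total x y x≢y
  ... | inj₁ Gxy′ = ⊥-elim (false≢true (trans (sym Gxy) Gxy′))
  ... | inj₂ Gyx = Gyx

  edge-or-reverse-or-equal : ∀ x y → ⟦ G x y ⟧ + ⟦ G y x ⟧ + δ x y ≡ 1
  edge-or-reverse-or-equal x y with x Fin.≟ y
  ... | yes refl rewrite loopless x = refl
  ... | no x≢y with G x y in Gxy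
  ...   | true rewrite asym x y Gxy = refl
  ...   | false rewrite complete x y x≢y Gxy = refl

  edges : (Fin n → ℕ) → (Fin n → ℕ) → ℕ
  edges p q = sum (λ x → sum (λ y → p x * q y * ⟦ G x y ⟧))

  E : (Fin n → Bool) → (Fin n → Bool) → ℕ
  E P Q = edges (χ P) (χ Q)

  edges-+ʳ : ∀ p q r → edges p (λ y → q y + r y) ≡ edges p q + edges p r
  edges-+ʳ p q r = trans
    (sum-cong-≗ (λ x → sum-cong-≗ (λ y → distrib (p x) (q y) (r y) ⟦ G x y ⟧)))
    (∑∑-distrib-+ (λ x y → p x * q y * ⟦ G x y ⟧) (λ x y → p x * r y * ⟦ G x y ⟧))
    where
    distrib : ∀ a b c e → a * (b + c) * e ≡ a * b * e + a * c * e
    distrib = solve-∀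

  edges-congʳ : ∀ p {q r} → (∀ y → q y ≡ r y) → edges p q ≡ edges p r
  edges-congʳ p q≗r =
    sum-cong-≗ (λ x → sum-cong-≗ (λ y → cong (λ t → p x * t * ⟦ G x y ⟧) (q≗r y)))

  edges-δʳ : ∀ p v → edges p (δ v) ≡ sum (λ x → p x * ⟦ G x v ⟧)
  edges-δʳ p v = sum-cong-≗ (λ x →
    trans (sum-cong-≗ (λ y → reassoc (p x) (δ v y) ⟦ G x y ⟧)) (sum-δ v (λ y → p x * ⟦ G x y ⟧)))
    where
    reassoc : ∀ a b c → a * b * c ≡ b * (a * c)
    reassoc = solve-∀

  edges-1ʳ : ∀ p → edges p (λ _ → 1) ≡ sum (λ x → p x * sum (λ y → ⟦ G x y ⟧))
  edges-1ʳ p = sum-cong-≗ (λ x →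
    trans (sum-cong-≗ (λ y → cong (_* ⟦ G x y ⟧) (*-identityʳ (p x))))
          (sym (*-distribˡ-sum (p x) (λ y → ⟦ G x y ⟧))))

  -- Each ordered pair (x, y) is counted once: as an edge x → y, as an edge y → x, or as x = y.
  edges-between : ∀ p q → edges p q + edges q p + sum (λ x → p x * q x) ≡ sum p * sum q
  edges-between p q = begin
    edges p q + edges q p + sum (λ x → p x * q x)
      ≡⟨ cong₂ (λ s t → edges p q + s + t) (∑-comm (λ x y → q x * p y * ⟦ G x y ⟧))
               (sum-cong-≗ (λ x → sym (sum-δ x (λ y → p x * q y)))) ⟩
    ∑∑ forward + ∑∑ backward + ∑∑ diagonal
      ≡⟨ cong (_+ ∑∑ diagonal) (sym (∑∑-distrib-+ forward backward)) ⟩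
    ∑∑ (λ x y → forward x y + backward x y) + ∑∑ diagonal
      ≡⟨ sym (∑∑-distrib-+ (λ x y → forward x y + backward x y) diagonal) ⟩
    ∑∑ (λ x y → forward x y + backward x y + diagonal x y)
      ≡⟨ sum-cong-≗ (λ x → sum-cong-≗ (λ y → pair x y)) ⟩
    ∑∑ (λ x y → p x * q y)
      ≡⟨ sum-cong-≗ (λ x → sym (*-distribˡ-sum (p x) q)) ⟩
    sum (λ x → p x * sum q)
      ≡⟨ sym (*-distribʳ-sum (sum q) p) ⟩
    sum p * sum q ∎
    where
    open ≡-Reasoning
    ∑∑ : (Fin n → Fin n → ℕ) → ℕ
    ∑∑ f = sum (λ x → sum (f x))
    forward backward diagonal : Fin n → Fin n → ℕ
    forward x y = p x * q y * ⟦ G x y ⟧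
    backward x y = q y * p x * ⟦ G y x ⟧
    diagonal x y = δ x y * (p x * q y)
    factor : ∀ a b c d e → a * b * c + b * a * d + e * (a * b) ≡ a * b * (c + d + e)
    factor = solve-∀
    pair : ∀ x y → forward x y + backward x y + diagonal x y ≡ p x * q y
    pair x y = trans (factor (p x) (q y) ⟦ G x y ⟧ ⟦ G y x ⟧ (δ x y))
                     (trans (cong (p x * q y *_) (edge-or-reverse-or-equal x y)) (*-identityʳ _))

  edges-between-disjoint : ∀ P P′ → (∀ x → P x ≡ true → P′ x ≡ false) →
    E P P′ + E P′ P ≡ ∣ P ∣ * ∣ P′ ∣
  edges-between-disjoint P P′ P∩P′≡∅ = begin
    E P P′ + E P′ P
      ≡⟨ sym (+-identityʳ _) ⟩
    E P P′ + E P′ P + 0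
      ≡⟨ cong (E P P′ + E P′ P +_) (sym (sum-zero χ∩≡0)) ⟩
    E P P′ + E P′ P + sum (λ x → χ P x * χ P′ x)
      ≡⟨ edges-between (χ P) (χ P′) ⟩
    ∣ P ∣ * ∣ P′ ∣ ∎
    where
    open ≡-Reasoning
    χ∩≡0 : ∀ x → χ P x * χ P′ x ≡ 0
    χ∩≡0 x with P x in Px
    ... | false = refl
    ... | true rewrite P∩P′≡∅ x Px = refl

  edges-within : ∀ P → E P P + E P P + ∣ P ∣ ≡ ∣ P ∣ * ∣ P ∣
  edges-within P = trans (cong (E P P + E P P +_)
                               (sym (sum-cong-≗ (λ x → ⟦⟧-idem (P x)))))
                         (edges-between (χ P) (χ P))

  _↛_ : (Fin n → Bool) → (Fin n → Bool) → Set
  P ↛ Q = ∀ x y → P x ≡ true → Q y ≡ true → G x y ≡ false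

  ↛⇒edges≡0 : ∀ {P Q} → P ↛ Q → E P Q ≡ 0
  ↛⇒edges≡0 {P} {Q} P↛Q = sum-zero (λ x → sum-zero (λ y → no-edge x y))
    where
    no-edge : ∀ x y → χ P x * χ Q y * ⟦ G x y ⟧ ≡ 0
    no-edge x y with P x in Px | Q y in Qy
    ... | false | _ = refl
    ... | true | false = refl
    ... | true | true rewrite P↛Q x y Px Qy = refl

  edges≡0⇒↛ : ∀ {P Q} → E P Q ≡ 0 → P ↛ Q
  edges≡0⇒↛ {P} {Q} edges≡0 x y Px Qy with G x y in Gxy
  ... | false = refl
  ... | true = ⊥-elim (1≢0 (sum≡0⇒≡0 _ (sum≡0⇒≡0 _ edges≡0 x) y))
    where
    1≢0 : χ P x * χ Q y * ⟦ G x y ⟧ ≢ 0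
    1≢0 rewrite Px | Qy | Gxy = λ ()

square+double≡self : ∀ k t → k * k + 2 * t ≡ k → t ≡ 0 × (k ≡ 0 ⊎ k ≡ 1)
square+double≡self zero t eq = m+n≡0⇒m≡0 t eq , inj₁ refl
square+double≡self (suc zero) t eq = m+n≡0⇒m≡0 t (suc-injective eq) , inj₂ refl
square+double≡self k@(suc (suc j)) t eq =
  ⊥-elim (<-irrefl (sym eq) (≤-trans (m<m+n k {k + j * k} (s≤s z≤n)) (m≤m+n (k * k) (2 * t))))

square+self+double≡0 : ∀ k t → k * k + k + 2 * t ≡ 0 → t ≡ 0 × k ≡ 0
square+self+double≡0 k t eq =
  m+n≡0⇒m≡0 t (m+n≡0⇒n≡0 (k * k + k) eq) , m+n≡0⇒n≡0 (k * k) (m+n≡0⇒m≡0 _ eq)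

-- In ℤ the hypothesis reads (q - p)(q - p - 1) + 2t = 0, and k(k - 1) ≥ 0 for every integer k.
quadratic-gap : ∀ p q t → p * p + q * q + p + 2 * t ≡ 2 * (p * q) + q → t ≡ 0 × (q ≡ p ⊎ q ≡ suc p)
quadratic-gap p q t eq with ≤-total p q
... | inj₁ p≤q = above (m≤n⇒∃[o]m+o≡n p≤q) eq
  where
  above : (∃ λ k → p + k ≡ q) →
    p * p + q * q + p + 2 * t ≡ 2 * (p * q) + q → t ≡ 0 × (q ≡ p ⊎ q ≡ suc p)
  above (k , refl) eq′ with square+double≡self k t (+-cancelˡ-≡ (2 * (p * p) + 2 * (p * k) + p) _ _
                              (trans (sym (lhs p k t)) (trans eq′ (rhs p k))))
    where
    lhs : ∀ p k t → p * p + (p + k) * (p + k) + p + 2 * t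
                  ≡ 2 * (p * p) + 2 * (p * k) + p + (k * k + 2 * t)
    lhs = solve-∀
    rhs : ∀ p k → 2 * (p * (p + k)) + (p + k) ≡ 2 * (p * p) + 2 * (p * k) + p + k
    rhs = solve-∀
  ... | t≡0 , inj₁ refl = t≡0 , inj₁ (+-identityʳ p)
  ... | t≡0 , inj₂ refl = t≡0 , inj₂ (+-comm p 1)
... | inj₂ q≤p = below (m≤n⇒∃[o]m+o≡n q≤p) eq
  where
  below : (∃ λ k → q + k ≡ p) →
    p * p + q * q + p + 2 * t ≡ 2 * (p * q) + q → t ≡ 0 × (q ≡ p ⊎ q ≡ suc p)
  below (k , refl) eq′ with square+self+double≡0 k t (+-cancelˡ-≡ (2 * (q * q) + 2 * (q * k) + q) _ 0
                              (trans (sym (lhs q k t)) (trans eq′ (rhs q k))))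
    where
    lhs : ∀ q k t → (q + k) * (q + k) + q * q + (q + k) + 2 * t
                  ≡ 2 * (q * q) + 2 * (q * k) + q + (k * k + k + 2 * t)
    lhs = solve-∀
    rhs : ∀ q k → 2 * ((q + k) * q) + q ≡ 2 * (q * q) + 2 * (q * k) + q + 0
    rhs = solve-∀
  ... | t≡0 , refl = t≡0 , inj₁ (sym (+-identityʳ q))

split-count-arithmetic : ∀ m p q r w xx qq xa ax qb bq xq qx →
  p * m ≡ xx + xa + xq → q * m ≡ q + qq + qb + qx → p + r ≡ m → q + w ≡ m →
  xx + xx + p ≡ p * p → qq + qq + q ≡ q * q →
  xa + ax ≡ p * r → qb + bq ≡ q * w → xq + qx ≡ p * q →
  p * p + q * q + p + 2 * (ax + bq) ≡ 2 * (p * q) + q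
split-count-arithmetic m p q r w xx qq xa ax qb bq xq qx
  out-p out-q p+r q+w pairs-p pairs-q p×r q×w p×q =
  +-cancelˡ-≡ (p * p + q * q + q + 2 * (xa + qb)) _ _ (trans (sym by-sizes) by-out-degrees)
  where
  open ≡-Reasoning
  total : ℕ
  total = 2 * (p * m) + 2 * (q * m) + p + q
  expand : ∀ p q r w → 2 * (p * (p + r)) + 2 * (q * (q + w)) + p + q
                     ≡ 2 * (p * p) + 2 * (q * q) + 2 * (p * r) + 2 * (q * w) + p + q
  expand = solve-∀
  regroup₁ : ∀ p q xa ax qb bq → 2 * (p * p) + 2 * (q * q) + 2 * (xa + ax) + 2 * (qb + bq) + p + q
                               ≡ p * p + q * q + q + 2 * (xa + qb) + (p * p + q * q + p + 2 * (ax + bq))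
  regroup₁ = solve-∀
  regroup₂ : ∀ p q xx qq xa qb xq qx → 2 * (xx + xa + xq) + 2 * (q + qq + qb + qx) + p + q
                                     ≡ (xx + xx + p) + (qq + qq + q) + 2 * (xq + qx) + q + q + 2 * (xa + qb)
  regroup₂ = solve-∀
  regroup₃ : ∀ p q xa qb → p * p + q * q + 2 * (p * q) + q + q + 2 * (xa + qb)
                         ≡ p * p + q * q + q + 2 * (xa + qb) + (2 * (p * q) + q)
  regroup₃ = solve-∀
  by-sizes : total ≡ p * p + q * q + q + 2 * (xa + qb) + (p * p + q * q + p + 2 * (ax + bq))
  by-sizes = begin
    total
      ≡⟨ cong₂ (λ a b → 2 * (p * a) + 2 * (q * b) + p + q) (sym p+r) (sym q+w) ⟩
    2 * (p * (p + r)) + 2 * (q * (q + w)) + p + q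
      ≡⟨ expand p q r w ⟩
    2 * (p * p) + 2 * (q * q) + 2 * (p * r) + 2 * (q * w) + p + q
      ≡⟨ cong₂ (λ a b → 2 * (p * p) + 2 * (q * q) + 2 * a + 2 * b + p + q) (sym p×r) (sym q×w) ⟩
    2 * (p * p) + 2 * (q * q) + 2 * (xa + ax) + 2 * (qb + bq) + p + q
      ≡⟨ regroup₁ p q xa ax qb bq ⟩
    p * p + q * q + q + 2 * (xa + qb) + (p * p + q * q + p + 2 * (ax + bq)) ∎
  by-out-degrees : total ≡ p * p + q * q + q + 2 * (xa + qb) + (2 * (p * q) + q)
  by-out-degrees = begin
    total
      ≡⟨ cong₂ (λ a b → 2 * a + 2 * b + p + q) out-p out-q ⟩
    2 * (xx + xa + xq) + 2 * (q + qq + qb + qx) + p + q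
      ≡⟨ regroup₂ p q xx qq xa qb xq qx ⟩
    (xx + xx + p) + (qq + qq + q) + 2 * (xq + qx) + q + q + 2 * (xa + qb)
      ≡⟨ cong₂ (λ a b → a + b + 2 * (xq + qx) + q + q + 2 * (xa + qb)) pairs-p pairs-q ⟩
    p * p + q * q + 2 * (xq + qx) + q + q + 2 * (xa + qb)
      ≡⟨ cong (λ a → p * p + q * q + 2 * a + q + q + 2 * (xa + qb)) p×q ⟩
    p * p + q * q + 2 * (p * q) + q + q + 2 * (xa + qb)
      ≡⟨ regroup₃ p q xa qb ⟩
    p * p + q * q + q + 2 * (xa + qb) + (2 * (p * q) + q) ∎

module RegularTournament (m : ℕ) (G : Digraph (suc (2 * m))) (R : IsRegularTournament m G) where

  open Tournament G (proj₁ R) public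

  out-degree : ∀ x → sum (λ y → ⟦ G x y ⟧) ≡ m
  out-degree x = trans (sym (length-filter-tabulate (G x) id)) (proj₁ (proj₂ R) x)

  in-degree : ∀ x → sum (λ y → ⟦ G y x ⟧) ≡ m
  in-degree x = trans (sym (length-filter-tabulate (λ y → G y x) id)) (proj₂ (proj₂ R) x)

  edges-1ʳ-regular : ∀ p → edges p (λ _ → 1) ≡ sum p * m
  edges-1ʳ-regular p = begin
    edges p (λ _ → 1)                          ≡⟨ edges-1ʳ p ⟩
    sum (λ x → p x * sum (λ y → ⟦ G x y ⟧))  ≡⟨ sum-cong-≗ (λ x → cong (p x *_) (out-degree x)) ⟩
    sum (λ x → p x * m)                        ≡⟨ sym (*-distribʳ-sum m p) ⟩
    sum p * m                                  ∎
    where open ≡-Reasoning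

  module Around (v : Fin (suc (2 * m))) where

    Out In : Fin (suc (2 * m)) → Bool
    Out = G v
    In y = G y v

    module Split (X Q : Fin (suc (2 * m)) → Bool) (X⊆Out : X ⊆ Out) (Q⊆In : Q ⊆ In) where

      A′ B′ : Fin (suc (2 * m)) → Bool
      A′ = Out ∖ X
      B′ = In ∖ Q

      partition : ∀ y → 1 ≡ δ v y + (χ X y + (χ A′ y + (χ Q y + χ B′ y)))
      partition y with v Fin.≟ y | X y in Xy | Q y in Qy
      ... | yes refl | true | _ = ⊥-elim (false≢true (trans (sym (loopless v)) (X⊆Out v Xy)))
      ... | yes refl | false | true = ⊥-elim (false≢true (trans (sym (loopless v)) (Q⊆In v Qy)))
      ... | yes refl | false | false rewrite loopless v = refl
      ... | no v≢y | true | true = ⊥-elim (false≢true (trans (sym (asym v y (X⊆Out y Xy))) (Q⊆In y Qy)))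
      ... | no v≢y | true | false rewrite asym v y (X⊆Out y Xy) | X⊆Out y Xy = refl
      ... | no v≢y | false | true rewrite asym y v (Q⊆In y Qy) | Q⊆In y Qy = refl
      ... | no v≢y | false | false with G v y in Gvy
      ...   | true rewrite asym v y Gvy = refl
      ...   | false rewrite complete v y v≢y Gvy = refl

      edges-partition : ∀ p → edges p (λ _ → 1) ≡
        edges p (δ v) + (edges p (χ X) + (edges p (χ A′) + (edges p (χ Q) + edges p (χ B′))))
      edges-partition p =
        trans (edges-congʳ p partition)
        (trans (edges-+ʳ p (δ v) (λ y → χ X y + (χ A′ y + (χ Q y + χ B′ y)))) (cong (edges p (δ v) +_)
        (trans (edges-+ʳ p (χ X) (λ y → χ A′ y + (χ Q y + χ B′ y))) (cong (edges p (χ X) +_)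
        (trans (edges-+ʳ p (χ A′) (λ y → χ Q y + χ B′ y)) (cong (edges p (χ A′) +_)
        (edges-+ʳ p (χ Q) (χ B′))))))))

      X∩A′≡∅ : ∀ x → X x ≡ true → A′ x ≡ false
      X∩A′≡∅ x Xx rewrite Xx = ∧-zeroʳ (G v x)

      X∩Q≡∅ : ∀ x → X x ≡ true → Q x ≡ false
      X∩Q≡∅ x Xx with Q x in Qx
      ... | false = refl
      ... | true = ⊥-elim (false≢true (trans (sym (asym v x (X⊆Out x Xx))) (Q⊆In x Qx)))

      Q∩B′≡∅ : ∀ x → Q x ≡ true → B′ x ≡ false
      Q∩B′≡∅ x Qx rewrite Qx = ∧-zeroʳ (G x v)

      out-of-X : X ↛ B′ → ∣ X ∣ * m ≡ E X X + E X A′ + E X Q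
      out-of-X X↛B′ = begin
        ∣ X ∣ * m
          ≡⟨ sym (edges-1ʳ-regular (χ X)) ⟩
        edges (χ X) (λ _ → 1)
          ≡⟨ edges-partition (χ X) ⟩
        edges (χ X) (δ v) + (E X X + (E X A′ + (E X Q + E X B′)))
          ≡⟨ cong₂ (λ a b → a + (E X X + (E X A′ + (E X Q + b))))
                   (trans (edges-δʳ (χ X) v) (sum-zero X↛v)) (↛⇒edges≡0 X↛B′) ⟩
        0 + (E X X + (E X A′ + (E X Q + 0)))
          ≡⟨ regroup (E X X) (E X A′) (E X Q) ⟩
        E X X + E X A′ + E X Q ∎
        where
        open ≡-Reasoning
        X↛v : ∀ x → χ X x * ⟦ G x v ⟧ ≡ 0
        X↛v x with X x in Xx
        ... | false = refl
        ... | true rewrite asym v x (X⊆Out x Xx) = refl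
        regroup : ∀ a b c → 0 + (a + (b + (c + 0))) ≡ a + b + c
        regroup = solve-∀

      out-of-Q : Q ↛ A′ → ∣ Q ∣ * m ≡ ∣ Q ∣ + E Q Q + E Q B′ + E Q X
      out-of-Q Q↛A′ = begin
        ∣ Q ∣ * m
          ≡⟨ sym (edges-1ʳ-regular (χ Q)) ⟩
        edges (χ Q) (λ _ → 1)
          ≡⟨ edges-partition (χ Q) ⟩
        edges (χ Q) (δ v) + (E Q X + (E Q A′ + (E Q Q + E Q B′)))
          ≡⟨ cong₂ (λ a b → a + (E Q X + (b + (E Q Q + E Q B′))))
                   (trans (edges-δʳ (χ Q) v) (sum-cong-≗ Q→v)) (↛⇒edges≡0 Q↛A′) ⟩
        ∣ Q ∣ + (E Q X + (0 + (E Q Q + E Q B′)))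
          ≡⟨ regroup ∣ Q ∣ (E Q X) (E Q Q) (E Q B′) ⟩
        ∣ Q ∣ + E Q Q + E Q B′ + E Q X ∎
        where
        open ≡-Reasoning
        Q→v : ∀ x → χ Q x * ⟦ G x v ⟧ ≡ χ Q x
        Q→v x with Q x in Qx
        ... | false = refl
        ... | true rewrite Q⊆In x Qx = refl
        regroup : ∀ q a b c → q + (a + (0 + (b + c))) ≡ q + b + c + a
        regroup = solve-∀

    -- Double counting the out-degrees (all m) of X and of Q gives
    -- (∣Q∣ - ∣X∣)(∣Q∣ - ∣X∣ - 1) + 2 (E A′ X + E B′ Q) = 0, where A′ = Out ∖ X and B′ = In ∖ Q.
    split-count : (X Q : Fin (suc (2 * m)) → Bool) → X ⊆ Out → Q ⊆ In →
      X ↛ (In ∖ Q) → Q ↛ (Out ∖ X) →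
      (∣ Q ∣ ≡ ∣ X ∣ ⊎ ∣ Q ∣ ≡ suc ∣ X ∣) × (Out ∖ X) ↛ X
    split-count X Q X⊆Out Q⊆In X↛B′ Q↛A′ = proj₂ gap , edges≡0⇒↛ (m+n≡0⇒m≡0 _ (proj₁ gap))
      where
      open Split X Q X⊆Out Q⊆In
      gap : E A′ X + E B′ Q ≡ 0 × (∣ Q ∣ ≡ ∣ X ∣ ⊎ ∣ Q ∣ ≡ suc ∣ X ∣)
      gap = quadratic-gap (∣ X ∣) (∣ Q ∣) _
        (split-count-arithmetic m (∣ X ∣) (∣ Q ∣) (∣ A′ ∣) (∣ B′ ∣)
        (E X X) (E Q Q) (E X A′) (E A′ X) (E Q B′) (E B′ Q) (E X Q) (E Q X)
        (out-of-X X↛B′) (out-of-Q Q↛A′)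
        (trans (∣∣-split {P = X} {Out} X⊆Out) (out-degree v))
        (trans (∣∣-split {P = Q} {In} Q⊆In) (in-degree v))
        (edges-within X) (edges-within Q)
        (edges-between-disjoint X A′ X∩A′≡∅) (edges-between-disjoint Q B′ Q∩B′≡∅)
        (edges-between-disjoint X Q X∩Q≡∅))

module Ranking (m : ℕ) (G : Digraph (suc (2 * m))) (R : IsRegularTournament m G)
               (v : Fin (suc (2 * m))) (no-cycle : ¬ HasAlternatingFourCycle G v) where

  open RegularTournament m G R
  open Around v public

  Vertex : Set
  Vertex = Fin (suc (2 * m))

  out≢in : ∀ {a b} → Out a ≡ true → In b ≡ true → a ≢ b
  out≢in {a} Oa Ia refl = false≢true (trans (sym (asym v a Oa)) Ia)

  beaten : Vertex → Vertex → Bool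
  beaten a b = In b ∧ G a b

  score : Vertex → ℕ
  score a = ∣ beaten a ∣

  -- Without alternating four-cycles the sets beaten a, for a ∈ Out, form a chain under inclusion.
  nested : ∀ {a a′ b b′} → Out a ≡ true → Out a′ ≡ true → In b ≡ true → In b′ ≡ true →
    G a b ≡ true → G a′ b ≡ false → G a′ b′ ≡ true → G a b′ ≡ true
  nested {a} {a′} {b} {b′} Oa Oa′ Ib Ib′ Gab Ga′b Ga′b′ with G a b′ in Gab′
  ... | true = refl
  ... | false = ⊥-elim (no-cycle (a , b , a′ , b′ , Gab ,
                  complete a′ b (out≢in Oa′ Ib) Ga′b , Ga′b′ ,
                  complete a b′ (out≢in Oa Ib′) Gab′ , Oa , Oa′ , Ib , Ib′))

  score-≤⇒beaten-⊆ : ∀ {a a′} → Out a ≡ true → Out a′ ≡ true →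
    score a ≤ score a′ → beaten a ⊆ beaten a′
  score-≤⇒beaten-⊆ {a} {a′} Oa Oa′ sa≤sa′ b beats with ∧≡true⇒ {In b} beats
  ... | Ib , Gab with G a′ b in Ga′b
  ...   | true rewrite Ib = refl
  ...   | false = ⊥-elim (<⇒≱ (∣∣-mono-< beaten-a′⊆beaten-a b a′↛b beats) sa≤sa′)
    where
    a′↛b : beaten a′ b ≡ false
    a′↛b = trans (cong (In b ∧_) Ga′b) (∧-zeroʳ (In b))
    beaten-a′⊆beaten-a : beaten a′ ⊆ beaten a
    beaten-a′⊆beaten-a b′ beats′ with ∧≡true⇒ {In b′} beats′
    ... | Ib′ , Ga′b′ rewrite Ib′ = nested Oa Oa′ Ib Ib′ Gab Ga′b Ga′b′

  beaten⊆In : ∀ a → beaten a ⊆ In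
  beaten⊆In a b beats = proj₁ (∧≡true⇒ {In b} beats)

  Below : ℕ → Vertex → Bool
  Below t x = Out x ∧ does (score x <? t)

  Below⊆Out : ∀ t → Below t ⊆ Out
  Below⊆Out t x x∈ = proj₁ (∧≡true⇒ {Out x} x∈)

  Below⇒< : ∀ {t x} → Below t x ≡ true → score x < t
  Below⇒< {t} {x} x∈ = does≡true⇒ (score x <? t) (proj₂ (∧≡true⇒ {Out x} x∈))

  Out∖Below⇒≥ : ∀ {t x} → (Out ∖ Below t) x ≡ true → Out x ≡ true × t ≤ score x
  Out∖Below⇒≥ {t} {x} x∈ with ∖≡true⇒ {P = Out} {Below t} x∈
  ... | Ox , x∉ rewrite Ox = refl , ≮⇒≥ (does≡false⇒ (score x <? t) x∉)

  ≮⇒∉Below : ∀ {t x} → ¬ score x < t → Below t x ≡ false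
  ≮⇒∉Below {t} {x} sx≮t = trans (cong (Out x ∧_) (dec-false (score x <? t) sx≮t)) (∧-zeroʳ (Out x))

  split-at : ∀ {a} t → Out a ≡ true → score a ≤ t → t ≤ suc (score a) →
    (score a ≡ ∣ Below t ∣ ⊎ score a ≡ suc ∣ Below t ∣) × (Out ∖ Below t) ↛ Below t
  split-at {a} t Oa sa≤t t≤1+sa =
    split-count (Below t) (beaten a) (Below⊆Out t) (beaten⊆In a) Below↛ beaten↛
    where
    Below↛ : Below t ↛ (In ∖ beaten a)
    Below↛ x y x∈ y∈ with G x y in Gxy | ∖≡true⇒ {P = In} {beaten a} y∈
    ... | false | _ = refl
    ... | true | Iy , a↛y = ⊥-elim (false≢true (trans (sym a↛y) a→y))
      where
      x→y : beaten x y ≡ true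
      x→y rewrite Iy = Gxy
      a→y : beaten a y ≡ true
      a→y = score-≤⇒beaten-⊆ (Below⊆Out t x x∈) Oa (≤-pred (≤-trans (Below⇒< x∈) t≤1+sa)) y x→y
    beaten↛ : beaten a ↛ (Out ∖ Below t)
    beaten↛ y x a→y x∈ with Out∖Below⇒≥ x∈
    ... | Ox , t≤sx = asym x y (proj₂ (∧≡true⇒ {In y} x→y))
      where
      x→y : beaten x y ≡ true
      x→y = score-≤⇒beaten-⊆ Oa Ox (≤-trans sa≤t t≤sx) y a→y

  Tied : ℕ → Vertex → Bool
  Tied s x = Out x ∧ does (score x ≟ s)

  ∣Below-suc∣ : ∀ s → ∣ Below (suc s) ∣ ≡ ∣ Below s ∣ + ∣ Tied s ∣
  ∣Below-suc∣ s = trans (sum-cong-≗ χ-split) (∑-distrib-+ (χ (Below s)) (χ (Tied s)))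
    where
    χ-split : ∀ x → χ (Below (suc s)) x ≡ χ (Below s) x + χ (Tied s) x
    χ-split x with Out x
    ... | false = refl
    ... | true with <-cmp (score x) s
    ...   | tri< sx<s sx≢s _ rewrite dec-true (score x <? suc s) (m<n⇒m<1+n sx<s)
                                 | dec-true (score x <? s) sx<s | dec-false (score x ≟ s) sx≢s = refl
    ...   | tri≈ sx≮s sx≡s _ rewrite dec-true (score x <? suc s) (s≤s (≤-reflexive sx≡s))
                                 | dec-false (score x <? s) sx≮s | dec-true (score x ≟ s) sx≡s = refl
    ...   | tri> sx≮s sx≢s s<sx rewrite dec-false (score x <? suc s) (<⇒≱ s<sx ∘ ≤-pred)
                                 | dec-false (score x <? s) sx≮s | dec-false (score x ≟ s) sx≢s = refl

  χ-Tied-self : ∀ {a} → Out a ≡ true → χ (Tied (score a)) a ≡ 1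
  χ-Tied-self {a} Oa rewrite Oa | dec-true (score a ≟ score a) refl = refl

  -- Splitting at t = score a and at t = score a + 1 pins down both counts.
  score-rank : ∀ {a} → Out a ≡ true → score a ≡ suc ∣ Below (score a) ∣ × ∣ Tied (score a) ∣ ≡ 1
  score-rank {a} Oa = squeeze (proj₁ (split-at (score a) Oa ≤-refl (n≤1+n _)))
    (subst (λ t → score a ≡ t ⊎ score a ≡ suc t) (∣Below-suc∣ (score a))
           (proj₁ (split-at (suc (score a)) Oa (n≤1+n _) ≤-refl)))
    (subst (_≤ ∣ Tied (score a) ∣) (χ-Tied-self Oa) (≤-sum (χ (Tied (score a))) a))
    where
    squeeze : ∀ {d b c} → d ≡ b ⊎ d ≡ suc b → d ≡ b + c ⊎ d ≡ suc (b + c) → 1 ≤ c →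
      d ≡ suc b × c ≡ 1
    squeeze {b = b} (inj₁ refl) (inj₁ e) 1≤c = ⊥-elim (<-irrefl e (m<m+n b 1≤c))
    squeeze {b = b} (inj₁ refl) (inj₂ e) 1≤c = ⊥-elim (<-irrefl e (s≤s (m≤m+n b _)))
    squeeze {b = b} (inj₂ refl) (inj₁ e) 1≤c = refl , sym (+-cancelˡ-≡ b 1 _ (trans (+-comm b 1) e))
    squeeze {b = b} (inj₂ refl) (inj₂ e) 1≤c = ⊥-elim (<-irrefl (suc-injective e) (m<m+n b 1≤c))

  score-range : ∀ {a} → Out a ≡ true → 1 ≤ score a × score a ≤ m
  score-range {a} Oa = subst (1 ≤_) (sym (proj₁ (score-rank Oa))) (s≤s z≤n) ,
                       ≤-trans (∣∣-mono (beaten⊆In a)) (≤-reflexive (in-degree v))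

  score-injective : ∀ {a a′} → Out a ≡ true → Out a′ ≡ true → score a ≡ score a′ → a ≡ a′
  score-injective {a} {a′} Oa Oa′ sa≡sa′ with a Fin.≟ a′
  ... | yes a≡a′ = a≡a′
  ... | no a≢a′ = ⊥-elim (<-irrefl refl (begin-strict
    1                                                  <⟨ s≤s (s≤s z≤n) ⟩
    2                                                  ≡⟨ cong₂ _+_ (sym (χ-Tied-self Oa)) (sym χ-a′) ⟩
    χ (Tied (score a)) a + χ (Tied (score a)) a′     ≤⟨ +≤-sum (χ (Tied (score a))) a≢a′ ⟩
    ∣ Tied (score a) ∣                                 ≡⟨ proj₂ (score-rank Oa) ⟩
    1                                                  ∎))
    where
    open ≤-Reasoning
    χ-a′ : χ (Tied (score a)) a′ ≡ 1
    χ-a′ = subst (λ s → χ (Tied s) a′ ≡ 1) (sym sa≡sa′) (χ-Tied-self Oa′)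

  score-<⇒edge : ∀ {a a′} → Out a ≡ true → Out a′ ≡ true → score a < score a′ → G a a′ ≡ true
  score-<⇒edge {a} {a′} Oa Oa′ sa<sa′ =
    complete a′ a (λ a′≡a → <-irrefl (cong score (sym a′≡a)) sa<sa′)
      (proj₂ (split-at (score a′) Oa′ ≤-refl (n≤1+n _)) a′ a a′∉ a∈)
    where
    a∈ : Below (score a′) a ≡ true
    a∈ rewrite Oa | dec-true (score a <? score a′) sa<sa′ = refl
    a′∉ : (Out ∖ Below (score a′)) a′ ≡ true
    a′∉ rewrite Oa′ | dec-false (score a′ <? score a′) (<-irrefl refl) = refl

  dominators : Vertex → ℕ
  dominators b = ∣ (λ x → Out x ∧ G x b) ∣

  score≡∣Below-suc∣ : ∀ {a} → Out a ≡ true → score a ≡ ∣ Below (suc (score a)) ∣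
  score≡∣Below-suc∣ {a} Oa = begin
    score a                                   ≡⟨ proj₁ (score-rank Oa) ⟩
    suc ∣ Below (score a) ∣                   ≡⟨ +-comm 1 _ ⟩
    ∣ Below (score a) ∣ + 1                   ≡⟨ cong (∣ Below (score a) ∣ +_) (sym (proj₂ (score-rank Oa))) ⟩
    ∣ Below (score a) ∣ + ∣ Tied (score a) ∣  ≡⟨ sym (∣Below-suc∣ (score a)) ⟩
    ∣ Below (suc (score a)) ∣                 ∎
    where open ≡-Reasoning

  ∣Below∣+∣Out∖Below∣ : ∀ t → ∣ Below t ∣ + ∣ Out ∖ Below t ∣ ≡ m
  ∣Below∣+∣Out∖Below∣ t = trans (∣∣-split {P = Below t} {Out} (Below⊆Out t)) (out-degree v)

  score+dominators>m : ∀ {a b} → Out a ≡ true → In b ≡ true → G a b ≡ true →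
    suc m ≤ score a + dominators b
  score+dominators>m {a} {b} Oa Ib Gab = begin
    suc m
      ≡⟨ cong suc (sym (∣Below∣+∣Out∖Below∣ (score a))) ⟩
    suc (∣ Below (score a) ∣ + ∣ Out ∖ Below (score a) ∣)
      ≤⟨ s≤s (+-monoʳ-≤ (∣ Below (score a) ∣) (∣∣-mono upper⊆dominators)) ⟩
    suc (∣ Below (score a) ∣ + dominators b)
      ≡⟨ cong (_+ dominators b) (sym (proj₁ (score-rank Oa))) ⟩
    score a + dominators b ∎
    where
    open ≤-Reasoning
    a→b : beaten a b ≡ true
    a→b rewrite Ib = Gab
    upper⊆dominators : (Out ∖ Below (score a)) ⊆ (λ x → Out x ∧ G x b)
    upper⊆dominators x x∈ with Out∖Below⇒≥ x∈
    ... | Ox , sa≤sx = ∧≡true Ox (proj₂ (∧≡true⇒ {In b} (score-≤⇒beaten-⊆ Oa Ox sa≤sx b a→b)))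

  score+dominators≤m : ∀ {a b} → Out a ≡ true → In b ≡ true → G b a ≡ true →
    score a + dominators b ≤ m
  score+dominators≤m {a} {b} Oa Ib Gba = begin
    score a + dominators b
      ≡⟨ cong (_+ dominators b) (score≡∣Below-suc∣ Oa) ⟩
    ∣ Below (suc (score a)) ∣ + dominators b
      ≤⟨ +-monoʳ-≤ (∣ Below (suc (score a)) ∣) (∣∣-mono dominators⊆upper) ⟩
    ∣ Below (suc (score a)) ∣ + ∣ Out ∖ Below (suc (score a)) ∣
      ≡⟨ ∣Below∣+∣Out∖Below∣ (suc (score a)) ⟩
    m ∎
    where
    open ≤-Reasoning
    not-below : ∀ {x} → Out x ≡ true → G x b ≡ true → ¬ score x < suc (score a)
    not-below {x} Ox Gxb sx≤sa = false≢true (trans (sym (asym b a Gba))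
      (proj₂ (∧≡true⇒ {In b} (score-≤⇒beaten-⊆ Ox Oa (≤-pred sx≤sa) b x→b))))
      where
      x→b : beaten x b ≡ true
      x→b rewrite Ib = Gxb
    dominators⊆upper : (λ x → Out x ∧ G x b) ⊆ (Out ∖ Below (suc (score a)))
    dominators⊆upper x x∈ with ∧≡true⇒ {Out x} x∈
    ... | Ox , Gxb = ∖≡true {P = Out} {Below (suc (score a))} Ox (≮⇒∉Below (not-below Ox Gxb))

reverse : ∀ {n} → Digraph n → Digraph n
reverse G x y = G y x

reverse-tournament : ∀ {n} {G : Digraph n} → IsTournament G → IsTournament (reverse G)
reverse-tournament T = record
  { irrefl = IsTournament.irrefl T
  ; total = λ x y x≢y → swap (IsTournament.total T x y x≢y)
  ; antisym = λ x y → IsTournament.antisym T y x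
  }

reverse-regular : ∀ m (G : Digraph (suc (2 * m))) →
  IsRegularTournament m G → IsRegularTournament m (reverse G)
reverse-regular m G (T , out , in′) = reverse-tournament T , in′ , out

reverse-no-cycle : ∀ {n} (G : Digraph n) v →
  ¬ HasAlternatingFourCycle G v → ¬ HasAlternatingFourCycle (reverse G) v
reverse-no-cycle G v no-cycle (p , q , r , s , pq , qr , rs , sp , vp , vr , qv , sv) =
  no-cycle (q , p , s , r , pq , sp , rs , qr , qv , sv , vp , vr)

module _ {m : ℕ} where

  ∸≤⇒<+ : ∀ {p c d} → p + c ≡ suc (2 * m) → p ∸ d ≤ m → suc m ≤ d + c
  ∸≤⇒<+ {p} {c} {d} p+c≡N p∸d≤m = +-cancelˡ-≤ m (suc m) (d + c) (begin
    m + suc m      ≡⟨ half m ⟩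
    suc (2 * m)    ≡⟨ sym p+c≡N ⟩
    p + c          ≤⟨ +-monoˡ-≤ c (≤-trans (m≤n+m∸n p d) (+-monoʳ-≤ d p∸d≤m)) ⟩
    d + m + c      ≡⟨ shuffle d m c ⟩
    m + (d + c)    ∎)
    where
    open ≤-Reasoning
    half : ∀ m → m + suc m ≡ suc (2 * m)
    half = solve-∀
    shuffle : ∀ d m c → d + m + c ≡ m + (d + c)
    shuffle = solve-∀

  <+⇒∸≤ : ∀ {p c d} → p + c ≡ suc (2 * m) → suc m ≤ d + c → p ∸ d ≤ m
  <+⇒∸≤ {p} {c} {d} p+c≡N m<d+c = m≤n+o⇒m∸n≤o p d (+-cancelʳ-≤ c p (d + m) (begin
    p + c          ≡⟨ p+c≡N ⟩
    suc (2 * m)    ≡⟨ half m ⟩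
    m + suc m      ≤⟨ +-monoʳ-≤ m m<d+c ⟩
    m + (d + c)    ≡⟨ shuffle m d c ⟩
    d + m + c      ∎))
    where
    open ≤-Reasoning
    half : ∀ m → suc (2 * m) ≡ m + suc m
    half = solve-∀
    shuffle : ∀ m d c → m + (d + c) ≡ d + m + c
    shuffle = solve-∀

  ∸-upper-half : ∀ {p p′} → suc m ≤ p → p′ ≤ 2 * m → p′ ∸ p ≤ m
  ∸-upper-half {p} {p′} m<p p′≤2m = m≤n+o⇒m∸n≤o p′ p (begin
    p′        ≤⟨ p′≤2m ⟩
    2 * m     ≡⟨ double m ⟩
    m + m     ≤⟨ +-monoˡ-≤ m (≤-trans (n≤1+n m) m<p) ⟩
    p + m     ∎)
    where
    open ≤-Reasoning
    double : ∀ m → 2 * m ≡ m + m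
    double = solve-∀

  complement-range : ∀ {p c} → p + c ≡ suc (2 * m) → 1 ≤ c → c ≤ m → suc m ≤ p × p ≤ 2 * m
  complement-range {p} {c} p+c≡N 1≤c c≤m =
    +-cancelʳ-≤ c (suc m) p (begin
      suc m + c      ≤⟨ +-monoʳ-≤ (suc m) c≤m ⟩
      suc m + m      ≡⟨ half m ⟩
      suc (2 * m)    ≡⟨ sym p+c≡N ⟩
      p + c          ∎) ,
    +-cancelʳ-≤ 1 p (2 * m) (begin
      p + 1          ≤⟨ +-monoʳ-≤ p 1≤c ⟩
      p + c          ≡⟨ p+c≡N ⟩
      suc (2 * m)    ≡⟨ +-comm 1 (2 * m) ⟩
      2 * m + 1      ∎)
    where
    open ≤-Reasoning
    half : ∀ m → suc m + m ≡ suc (2 * m)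
    half = solve-∀

<-complement : ∀ {p c p′ c′} → p + c ≡ p′ + c′ → p < p′ → c′ < c
<-complement {c = c} {c′ = c′} p+c≡p′+c′ p<p′ with c′ <? c
... | yes c′<c = c′<c
... | no c′≮c = ⊥-elim (<-irrefl p+c≡p′+c′ (+-mono-<-≤ p<p′ (≮⇒≥ c′≮c)))

injective⇒surjective : ∀ {n} (f : Fin n → Fin n) → Injective _≡_ _≡_ f → ∀ j → ∃ λ i → f i ≡ j
injective⇒surjective f f-inj j with any? (λ i → f i Fin.≟ j)
... | yes hit = hit
injective⇒surjective {suc n} f f-inj j | no miss = ⊥-elim (<-irrefl refl (injective⇒≤ f′-inj))
  where
  f′ : Fin (suc n) → Fin n
  f′ i = punchOut {i = j} (λ j≡fi → miss (i , sym j≡fi))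
  f′-inj : Injective _≡_ _≡_ f′
  f′-inj {a} {b} eq =
    f-inj (punchOut-injective (λ j≡fa → miss (a , sym j≡fa)) (λ j≡fb → miss (b , sym j≡fb)) eq)

injective⇒↔ : ∀ {n} (f : Fin n → Fin n) → Injective _≡_ _≡_ f →
  Σ (Fin n ↔ Fin n) λ σ → ∀ i → f (Inverse.to σ i) ≡ i
injective⇒↔ {n} f f-inj = mk↔ₛ′ f⁻¹ f (λ i → f-inj (f∘f⁻¹ (f i))) f∘f⁻¹ , f∘f⁻¹
  where
  f⁻¹ : Fin n → Fin n
  f⁻¹ i = proj₁ (injective⇒surjective f f-inj i)
  f∘f⁻¹ : ∀ i → f (f⁻¹ i) ≡ i
  f∘f⁻¹ i = proj₂ (injective⇒surjective f f-inj i)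

module Positions (m : ℕ) (G : Digraph (suc (2 * m))) (R : IsRegularTournament m G)
                 (v : Fin (suc (2 * m))) (no-cycle : ¬ HasAlternatingFourCycle G v) where

  open RegularTournament m G R using (loopless; asym; complete)
  open Ranking m G R v no-cycle
    using (Vertex; Out; In; out≢in; score; dominators; score-range; score-injective; score-<⇒edge;
           score+dominators>m; score+dominators≤m)
  -- Reversing G swaps Out and In, and Reverse.score b is by definition dominators b.
  module Reverse = Ranking m (reverse G) (reverse-regular m G R) v (reverse-no-cycle G v no-cycle)

  N : ℕ
  N = suc (2 * m)

  data Side (x : Vertex) : Set where
    centre : x ≡ v → Side x
    outward : Out x ≡ true → Side x
    inward : In x ≡ true → Side x

  side : ∀ x → Side x
  side x with x Fin.≟ v | G v x in Gvx
  ... | yes x≡v | _ = centre x≡v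
  ... | no _ | true = outward Gvx
  ... | no x≢v | false = inward (complete v x (x≢v ∘ sym) Gvx)

  position : Vertex → ℕ
  position x with x Fin.≟ v | G v x
  ... | yes _ | _ = 0
  ... | no _ | true = score x
  ... | no _ | false = N ∸ dominators x

  position-centre : position v ≡ 0
  position-centre with v Fin.≟ v
  ... | yes _ = refl
  ... | no v≢v = ⊥-elim (v≢v refl)

  position-out : ∀ {a} → Out a ≡ true → position a ≡ score a
  position-out {a} Oa with a Fin.≟ v
  ... | yes refl = ⊥-elim (false≢true (trans (sym (loopless v)) Oa))
  ... | no _ rewrite Oa = refl

  position-in : ∀ {b} → In b ≡ true → position b + dominators b ≡ N
  position-in {b} Ib with b Fin.≟ v
  ... | yes refl = ⊥-elim (false≢true (trans (sym (loopless v)) Ib))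
  ... | no _ rewrite asym b v Ib =
    m∸n+n≡m (≤-trans (proj₂ (Reverse.score-range Ib)) (≤-trans (m≤m+n m (m + 0)) (n≤1+n _)))

  out-range : ∀ {a} → Out a ≡ true → 1 ≤ position a × position a ≤ m
  out-range Oa rewrite position-out Oa = score-range Oa

  in-range : ∀ {b} → In b ≡ true → suc m ≤ position b × position b ≤ 2 * m
  in-range Ib =
    complement-range (position-in Ib) (proj₁ (Reverse.score-range Ib)) (proj₂ (Reverse.score-range Ib))

  position<N : ∀ x → position x < N
  position<N x with side x
  ... | centre refl rewrite position-centre = s≤s z≤n
  ... | outward Ox = s≤s (≤-trans (proj₂ (out-range Ox)) (m≤m+n m (m + 0)))
  ... | inward Ix = s≤s (proj₂ (in-range Ix))

  centre<out : ∀ {a} → Out a ≡ true → position v < position a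
  centre<out Oa rewrite position-centre = proj₁ (out-range Oa)

  centre<in : ∀ {b} → In b ≡ true → position v < position b
  centre<in Ib rewrite position-centre = ≤-trans (s≤s z≤n) (proj₁ (in-range Ib))

  out<in : ∀ {a b} → Out a ≡ true → In b ≡ true → position a < position b
  out<in Oa Ib = ≤-trans (s≤s (proj₂ (out-range Oa))) (proj₁ (in-range Ib))

  position-injective : ∀ {x y} → position x ≡ position y → x ≡ y
  position-injective {x} {y} eq with side x | side y
  ... | centre refl | centre refl = refl
  ... | centre refl | outward Oy = ⊥-elim (<-irrefl eq (centre<out Oy))
  ... | centre refl | inward Iy = ⊥-elim (<-irrefl eq (centre<in Iy))
  ... | outward Ox | centre refl = ⊥-elim (<-irrefl (sym eq) (centre<out Ox))
  ... | inward Ix | centre refl = ⊥-elim (<-irrefl (sym eq) (centre<in Ix))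
  ... | outward Ox | inward Iy = ⊥-elim (<-irrefl eq (out<in Ox Iy))
  ... | inward Ix | outward Oy = ⊥-elim (<-irrefl (sym eq) (out<in Oy Ix))
  ... | outward Ox | outward Oy =
    score-injective Ox Oy (trans (sym (position-out Ox)) (trans eq (position-out Oy)))
  ... | inward Ix | inward Iy =
    Reverse.score-injective Ix Iy (+-cancelˡ-≡ (position x) _ _
      (trans (position-in Ix) (sym (subst (λ p → p + dominators y ≡ N) (sym eq) (position-in Iy)))))

  Agrees : Vertex → Vertex → Set
  Agrees x y = (G x y ≡ true → position y ∸ position x ≤ m)
             × (position y ∸ position x ≤ m → G x y ≡ true)

  agrees : ∀ x y → position x < position y → Agrees x y
  agrees x y lt with side x | side y
  ... | centre refl | centre refl = ⊥-elim (<-irrefl refl lt)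
  ... | outward Ox | centre refl = ⊥-elim (<-asym lt (centre<out Ox))
  ... | inward Ix | centre refl = ⊥-elim (<-asym lt (centre<in Ix))
  ... | inward Ix | outward Oy = ⊥-elim (<-asym lt (out<in Oy Ix))
  ... | centre refl | outward Oy =
    (λ _ → ≤-trans (m∸n≤m (position y) (position x)) (proj₂ (out-range Oy))) , (λ _ → Oy)
  ... | centre refl | inward Iy =
    (λ Gvy → ⊥-elim (false≢true (trans (sym (asym y v Iy)) Gvy))) ,
    (λ close → ⊥-elim (<⇒≱ (proj₁ (in-range Iy))
                             (subst (λ p → position y ∸ p ≤ m) position-centre close)))
  ... | outward Ox | outward Oy =
    (λ _ → ≤-trans (m∸n≤m (position y) (position x)) (proj₂ (out-range Oy))) ,
    (λ _ → score-<⇒edge Ox Oy (subst₂ _<_ (position-out Ox) (position-out Oy) lt))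
  ... | outward Ox | inward Iy rewrite position-out Ox =
    (λ Gxy → <+⇒∸≤ {p = position y} {dominators y} {score x} (position-in Iy)
                    (score+dominators>m Ox Iy Gxy)) ,
    close⇒edge
    where
    close⇒edge : position y ∸ score x ≤ m → G x y ≡ true
    close⇒edge close with G x y in Gxy
    ... | true = refl
    ... | false = ⊥-elim (<⇒≱ (∸≤⇒<+ {p = position y} {dominators y} {score x} (position-in Iy) close)
                    (score+dominators≤m Ox Iy (complete x y (out≢in Ox Iy) Gxy)))
  ... | inward Ix | inward Iy =
    (λ _ → ∸-upper-half (proj₁ (in-range Ix)) (proj₂ (in-range Iy))) ,
    (λ _ → Reverse.score-<⇒edge Iy Ix
             (<-complement (trans (position-in Ix) (sym (position-in Iy))) lt))

  place : Vertex → Fin N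
  place x = fromℕ< (position<N x)

  toℕ-place : ∀ x → toℕ (place x) ≡ position x
  toℕ-place x = toℕ-fromℕ< (position<N x)

  place-injective : Injective _≡_ _≡_ place
  place-injective {x} {y} eq =
    position-injective (trans (sym (toℕ-place x)) (trans (cong toℕ eq) (toℕ-place y)))

mainTheorem9 : (m : ℕ) (H : Digraph (suc (2 * m))) → IsRegularTournament m H →
    (v : Fin (suc (2 * m))) → ¬ HasAlternatingFourCycle H v → IsCyclic m H
mainTheorem9 m H R v no-cycle = σ , λ i j i<j → agrees-at i j (agrees (vertex i) (vertex j)
  (subst₂ _<_ (sym (position-vertex i)) (sym (position-vertex j)) i<j))
  where
  open Positions m H R v no-cycle
  ordering : Σ (Fin N ↔ Fin N) λ σ → ∀ i → place (Inverse.to σ i) ≡ i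
  ordering = injective⇒↔ place place-injective
  σ : Fin N ↔ Fin N
  σ = proj₁ ordering
  vertex : Fin N → Fin N
  vertex = Inverse.to σ
  position-vertex : ∀ i → position (vertex i) ≡ toℕ i
  position-vertex i = trans (sym (toℕ-place (vertex i))) (cong toℕ (proj₂ ordering i))
  agrees-at : ∀ i j → Agrees (vertex i) (vertex j) →
    (vertex i ⇒[ H ] vertex j → toℕ j ∸ toℕ i ≤ m)
    × (toℕ j ∸ toℕ i ≤ m → vertex i ⇒[ H ] vertex j)
  agrees-at i j agree rewrite position-vertex i | position-vertex j = agree
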